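{- Let $s_1,s_2\ge1$ be integers with $s_1+s_2>2$ and put $s=s_1+s_2-2$. Then, with $\mathrm{d}=q\frac{d}{dq}$, \[ \binom{s}{s_1-1}\frac{\mathrm{d}[s]}{s}=[s_1]\cdot[s_2]+\binom{s}{s_1-1}[s+1]-\sum_{\substack{a+b=s+2\\ a,b\ge1}}\left(\binom{a-1}{s_1-1}+\binom{a-1}{s_2-1}\right)[a,b]. \]
   Context: For integers $r_1,\dots,r_l\ge 0$ and $n\ge 1$ let $\sigma_{r_1,\dots,r_l}(n)=\sum v_1^{r_1}\cdots v_l^{r_l}$, summed over positive integers $u_1>\dots>u_l>0$, $v_1,\dots,v_l>0$ with $u_1v_1+\dots+u_lv_l=n$. For integers $s_1,\dots,s_l\ge1$ the bracket is $[s_1,\dots,s_l]=\frac{1}{(s_1-1)!\cdots(s_l-1)!}\sum_{n>0}\sigma_{s_1-1,\dots,s_l-1}(n)q^n\in\mathbb{Q}[[q]]$. Binomial coefficients $\binom{n}{m}$ with $m>n\ge 0$ are $0$. -}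

module Defs where

open import Data.Nat as ℕ using (ℕ; zero; suc; _+_; _*_; _∸_; _^_; _≤ᵇ_; _≡ᵇ_; _!)
open import Data.Nat.Properties using (_!≢0; m*n≢0)
open import Relation.Binary.PropositionalEquality using (_≡_)
open import Data.Bool using (if_then_else_)
open import Data.List using (List; []; _∷_; map)
open import Data.Integer using (+_)
open import Data.Rational as ℚ using (ℚ; 0ℚ; _/_)

sumℕ : (ℕ → ℕ) → ℕ → ℕ
sumℕ f zero = 0
sumℕ f (suc m) = sumℕ f m + f m

sumℚ : (ℕ → ℚ) → ℕ → ℚ
sumℚ f zero = 0ℚ
sumℚ f (suc m) = sumℚ f m ℚ.+ f m

-- sigmaAux (r_1,…,r_l) n B
--   = Σ v_1^{r_1}⋯v_l^{r_l} over B > u_1 > … > u_l > 0, v_i > 0, Σ u_i v_i = n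
sigmaAux : List ℕ → ℕ → ℕ → ℕ
sigmaAux [] n B = if n ≡ᵇ 0 then 1 else 0
sigmaAux (r ∷ rs) n B =
  sumℕ (λ i → sumℕ (λ j →
      let u = suc i ; v = suc j in
      if u * v ≤ᵇ n then v ^ r * sigmaAux rs (n ∸ u * v) u else 0) n)
    (B ∸ 1)

-- σ_{r_1,…,r_l}(n)   (u_1 ≤ n is automatic, so the bound n+1 is no restriction)
σ : List ℕ → ℕ → ℕ
σ rs n = sigmaAux rs n (suc n)

Series : Set
Series = ℕ → ℚ

_≈ₛ_ : Series → Series → Set
f ≈ₛ g = ∀ n → f n ≡ g n
infix 4 _≈ₛ_

factProd : List ℕ → ℕ
factProd [] = 1
factProd (s ∷ ss) = (s ∸ 1) ! * factProd ss

factProd-nz : ∀ ss → ℕ.NonZero (factProd ss)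
factProd-nz [] = _
factProd-nz (s ∷ ss) = m*n≢0 ((s ∸ 1) !) (factProd ss) {{(s ∸ 1) !≢0}} {{factProd-nz ss}}

bracket : List ℕ → Series
bracket ss zero = 0ℚ
bracket ss (suc n) = ((+ σ (map (_∸ 1) ss) (suc n)) / factProd ss) {{factProd-nz ss}}

_⊕_ : Series → Series → Series
(f ⊕ g) n = f n ℚ.+ g n

_⊖_ : Series → Series → Series
(f ⊖ g) n = f n ℚ.- g n

_⊛_ : Series → Series → Series
(f ⊛ g) n = sumℚ (λ i → f i ℚ.* g (n ∸ i)) (suc n)

infixl 7 _⊛_
infixl 6 _⊕_ _⊖_

_·ₛ_ : ℕ → Series → Series
(c ·ₛ f) n = (+ c / 1) ℚ.* f n
infixr 8 _·ₛ_

-- division by a natural number s (only used for s ≥ 1; value at s = 0 is junk 0)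
divₛ : Series → ℕ → Series
divₛ f zero n = 0ℚ
divₛ f (suc k) n = f n ℚ.* (+ 1 / suc k)

dₛ : Series → Series
dₛ f n = (+ n / 1) ℚ.* f n

sumₛ : (ℕ → Series) → ℕ → Series
sumₛ F m n = sumℚ (λ i → F i n) m

-- Write kᵢ = sᵢ - 1, so that s = k₁ + k₂. Multiplying by k₁! k₂! and comparing coefficients of qⁿ,
-- the identity becomes one between divisor sums:
--   Σₜ σ_{k₁}(t) σ_{k₂}(n - t) + σ_s(n) = n σ_{s-1}(n) + Σᵢ (C(k₂, i - k₁) + C(k₁, i - k₂)) σ_{i,s-i}(n).
-- The convolution on the left is the sum of v₁^k₁ v₂^k₂ over u₁v₁ + u₂v₂ = n; split it according to
-- v₁ < v₂, v₁ > v₂ and v₁ = v₂. On the diagonal, u₁v + u₂v = uv has u - 1 solutions, so this part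
-- together with σ_s(n) is Σ_{uv=n} u v^s = n σ_{s-1}(n). Off the diagonal, the substitution
-- (u₁, v₁, u₂, v₂) ↦ (u₁ + u₂, v₁, u₂, v₂ - v₁) maps the terms with v₁ < v₂ onto the index set
-- {(U, v, u₂, w) : U > u₂, Uv + u₂w = n} of the depth-two sums, and the binomial expansion of
-- v^k₁ (v + w)^k₂ turns them into the sum of the σ_{i,s-i}; the part v₁ > v₂ is symmetric.

module Submission where

open import Defs
open import Data.Nat as ℕ
  using (ℕ; zero; suc; _+_; _*_; _∸_; _^_; _!; _≤_; _<_; _≥_; _>_; _≟_; _<?_; z≤n; s≤s; NonZero)
open import Data.Nat.Properties
open import Data.Nat.Combinatorics using (_C_; nCk≡n!/k![n-k]!; k![n∸k]!∣n!; k>n⇒nCk≡0)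
open import Data.Nat.DivMod using (m/n*n≡m)
open import Data.Nat.Solver using (module +-*-Solver)
open +-*-Solver
open import Data.Fin using (toℕ)
open import Data.List using ([]; _∷_; map)
open import Data.Bool using (T; true; false; if_then_else_)
open import Data.Empty using (⊥-elim)
open import Relation.Nullary using (Dec; does; yes; no; ¬_)
open import Relation.Binary.Definitions using (tri<; tri≈; tri>)
open import Relation.Binary.PropositionalEquality
import Algebra.Properties.CommutativeSemiring.Binomial +-*-commutativeSemiring as Binomial
import Algebra.Properties.Semiring.Exp +-*-semiring as Exp
import Algebra.Properties.Monoid.Mult +-0-monoid as Mult
import Algebra.Properties.Monoid.Sum +-0-monoid as Sum

𝟙 : {P : Set} → Dec P → ℕ
𝟙 d = if does d then 1 else 0

𝟙-yes : ∀ {P} (d : Dec P) → P → 𝟙 d ≡ 1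
𝟙-yes (yes _)  _ = refl
𝟙-yes (no ¬p)  p = ⊥-elim (¬p p)

𝟙-no : ∀ {P} (d : Dec P) → ¬ P → 𝟙 d ≡ 0
𝟙-no (yes p) ¬p = ⊥-elim (¬p p)
𝟙-no (no _)  _  = refl

-- Opaque, so that unification treats δ and χ< as rigid instead of unfolding them to if_then_else_.
opaque
  δ : ℕ → ℕ → ℕ
  δ a b = 𝟙 (a ≟ b)

  χ< : ℕ → ℕ → ℕ
  χ< a b = 𝟙 (a <? b)

  δ-≡ : ∀ {a b} → a ≡ b → δ a b ≡ 1
  δ-≡ {a} {b} = 𝟙-yes (a ≟ b)

  δ-≢ : ∀ {a b} → a ≢ b → δ a b ≡ 0
  δ-≢ {a} {b} = 𝟙-no (a ≟ b)

  χ<-< : ∀ {a b} → a < b → χ< a b ≡ 1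
  χ<-< {a} {b} = 𝟙-yes (a <? b)

  χ<-≮ : ∀ {a b} → ¬ a < b → χ< a b ≡ 0
  χ<-≮ {a} {b} = 𝟙-no (a <? b)

  χ<-suc : ∀ a b → χ< (suc a) (suc b) ≡ χ< a b
  χ<-suc a b = refl

  sigmaAux-[] : ∀ m B → sigmaAux [] m B ≡ δ m 0
  sigmaAux-[] m B = refl

δ-refl : ∀ a → δ a a ≡ 1
δ-refl a = δ-≡ refl

>⇒δ≡0 : ∀ {a b} → b < a → δ a b ≡ 0
>⇒δ≡0 b<a = δ-≢ (λ a≡b → <-irrefl (sym a≡b) b<a)

δ-cong-⇔ : ∀ {a b c d} → (a ≡ b → c ≡ d) → (c ≡ d → a ≡ b) → δ a b ≡ δ c d
δ-cong-⇔ {a} {b} {c} {d} to from with a ≟ b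
... | yes a≡b = trans (δ-≡ a≡b) (sym (δ-≡ (to a≡b)))
... | no  a≢b = trans (δ-≢ a≢b) (sym (δ-≢ (λ c≡d → a≢b (from c≡d))))

δ-∸ : ∀ {m n} k → m ≤ n → δ (m + k) n ≡ δ k (n ∸ m)
δ-∸ {m} {n} k m≤n =
  δ-cong-⇔ (λ e → trans (sym (m+n∸m≡n m k)) (cong (_∸ m) e))
           (λ e → trans (cong (m +_) e) (m+[n∸m]≡n m≤n))

χ<+δ+χ>≡1 : ∀ a b → χ< a b + χ< b a + δ a b ≡ 1
χ<+δ+χ>≡1 a b with <-cmp a b
... | tri< a<b _ b≮a rewrite χ<-< a<b | χ<-≮ b≮a | δ-≢ (<⇒≢ a<b) = refl
... | tri≈ a≮b refl _ rewrite χ<-≮ a≮b | δ-refl a = refl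
... | tri> a≮b _ b<a rewrite χ<-≮ a≮b | χ<-< b<a | δ-≢ (≢-sym (<⇒≢ b<a)) = refl

x*[c*y]≡0 : ∀ x {c} y → c ≡ 0 → x * (c * y) ≡ 0
x*[c*y]≡0 x y refl = *-zeroʳ x

sumℕ-cong : ∀ {f g} m → (∀ i → i < m → f i ≡ g i) → sumℕ f m ≡ sumℕ g m
sumℕ-cong zero    f≡g = refl
sumℕ-cong (suc m) f≡g = cong₂ _+_ (sumℕ-cong m (λ i i<m → f≡g i (m<n⇒m<1+n i<m))) (f≡g m (n<1+n m))

sumℕ-≡0 : ∀ {f} m → (∀ i → i < m → f i ≡ 0) → sumℕ f m ≡ 0
sumℕ-≡0 zero    f≡0 = refl
sumℕ-≡0 (suc m) f≡0 = cong₂ _+_ (sumℕ-≡0 m (λ i i<m → f≡0 i (m<n⇒m<1+n i<m))) (f≡0 m (n<1+n m))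

sumℕ-distrib-+ : ∀ f g m → sumℕ (λ i → f i + g i) m ≡ sumℕ f m + sumℕ g m
sumℕ-distrib-+ f g zero    = refl
sumℕ-distrib-+ f g (suc m) rewrite sumℕ-distrib-+ f g m =
  solve 4 (λ a b c d → a :+ b :+ (c :+ d) := a :+ c :+ (b :+ d)) refl (sumℕ f m) (sumℕ g m) (f m) (g m)

*-distribˡ-sumℕ : ∀ c f m → c * sumℕ f m ≡ sumℕ (λ i → c * f i) m
*-distribˡ-sumℕ c f zero    = *-zeroʳ c
*-distribˡ-sumℕ c f (suc m) = trans (*-distribˡ-+ c (sumℕ f m) (f m)) (cong (_+ c * f m) (*-distribˡ-sumℕ c f m))

*-distribʳ-sumℕ : ∀ c f m → sumℕ f m * c ≡ sumℕ (λ i → f i * c) m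
*-distribʳ-sumℕ c f m =
  trans (*-comm (sumℕ f m) c) (trans (*-distribˡ-sumℕ c f m) (sumℕ-cong m (λ i _ → *-comm c (f i))))

sumℕ-swap : ∀ (f : ℕ → ℕ → ℕ) m n →
  sumℕ (λ i → sumℕ (f i) n) m ≡ sumℕ (λ j → sumℕ (λ i → f i j) m) n
sumℕ-swap f zero    n = sym (sumℕ-≡0 n (λ _ _ → refl))
sumℕ-swap f (suc m) n =
  trans (cong (_+ sumℕ (f m) n) (sumℕ-swap f m n)) (sym (sumℕ-distrib-+ (λ j → sumℕ (λ i → f i j) m) (f m) n))

sumℕ-split : ∀ f a b → sumℕ f (a + b) ≡ sumℕ f a + sumℕ (λ i → f (a + i)) b
sumℕ-split f a zero    = trans (cong (sumℕ f) (+-identityʳ a)) (sym (+-identityʳ _))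
sumℕ-split f a (suc b) =
  trans (cong (sumℕ f) (+-suc a b)) (trans (cong (_+ f (a + b)) (sumℕ-split f a b)) (+-assoc (sumℕ f a) _ _))

sumℕ-extend : ∀ f {m M} → m ≤ M → (∀ i → m ≤ i → i < M → f i ≡ 0) → sumℕ f M ≡ sumℕ f m
sumℕ-extend f {m} {M} m≤M f≡0 = begin
  sumℕ f M                                   ≡⟨ cong (sumℕ f) (m+[n∸m]≡n m≤M) ⟨
  sumℕ f (m + (M ∸ m))                       ≡⟨ sumℕ-split f m (M ∸ m) ⟩
  sumℕ f m + sumℕ (λ i → f (m + i)) (M ∸ m)  ≡⟨ cong (sumℕ f m +_) (sumℕ-≡0 (M ∸ m) tail≡0) ⟩
  sumℕ f m + 0                               ≡⟨ +-identityʳ _ ⟩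
  sumℕ f m                                   ∎
  where
  open ≡-Reasoning
  tail≡0 : ∀ i → i < M ∸ m → f (m + i) ≡ 0
  tail≡0 i i<M∸m = f≡0 (m + i) (m≤m+n m i) (subst (m + i <_) (m+[n∸m]≡n m≤M) (+-monoʳ-< m i<M∸m))

sumℕ-shift : ∀ f c M → (∀ i → i < c → f i ≡ 0) → (∀ j → M ≤ c + j → f (c + j) ≡ 0) →
             sumℕ f M ≡ sumℕ (λ j → f (c + j)) M
sumℕ-shift f c M f≡0-below f≡0-above with c ℕ.≤? M
... | yes c≤M = begin
  sumℕ f M                                   ≡⟨ cong (sumℕ f) (m+[n∸m]≡n c≤M) ⟨
  sumℕ f (c + (M ∸ c))                       ≡⟨ sumℕ-split f c (M ∸ c) ⟩
  sumℕ f c + sumℕ (λ j → f (c + j)) (M ∸ c)  ≡⟨ cong (_+ sumℕ (λ j → f (c + j)) (M ∸ c)) (sumℕ-≡0 c f≡0-below) ⟩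
  sumℕ (λ j → f (c + j)) (M ∸ c)             ≡⟨ sumℕ-extend (λ j → f (c + j)) (m∸n≤m M c) tail≡0 ⟨
  sumℕ (λ j → f (c + j)) M                   ∎
  where
  open ≡-Reasoning
  tail≡0 : ∀ j → M ∸ c ≤ j → j < M → f (c + j) ≡ 0
  tail≡0 j M∸c≤j _ = f≡0-above j (subst (_≤ c + j) (m+[n∸m]≡n c≤M) (+-monoʳ-≤ c M∸c≤j))
... | no c≰M = trans (sumℕ-≡0 M (λ i i<M → f≡0-below i (<-≤-trans i<M (≰⇒≥ c≰M))))
                     (sym (sumℕ-≡0 M (λ j _ → f≡0-above j (≤-trans (≰⇒≥ c≰M) (m≤m+n c j)))))

sumℕ-single : ∀ f {a} M → a < M → (∀ i → i < M → i ≢ a → f i ≡ 0) → sumℕ f M ≡ f a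
sumℕ-single f {a} (suc M) a<1+M f≡0 with a ≟ M
... | yes refl = cong (_+ f a) (sumℕ-≡0 a (λ i i<a → f≡0 i (m<n⇒m<1+n i<a) (<⇒≢ i<a)))
... | no  a≢M  = trans (cong₂ _+_ (sumℕ-single f M (≤∧≢⇒< (≤-pred a<1+M) a≢M) (λ i i<M → f≡0 i (m<n⇒m<1+n i<M)))
                                  (f≡0 M (n<1+n M) (≢-sym a≢M)))
                       (+-identityʳ _)

sumℕ-χ< : ∀ {i} n → i ≤ n → sumℕ (λ k → χ< k i) n ≡ i
sumℕ-χ< {i} n i≤n = trans (sumℕ-extend (λ k → χ< k i) i≤n (λ k i≤k _ → χ<-≮ (≤⇒≯ i≤k)))
                           (trans (sumℕ-cong i (λ k k<i → χ<-< k<i)) (count i))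
  where
  count : ∀ i → sumℕ (λ _ → 1) i ≡ i
  count zero    = refl
  count (suc i) = trans (cong (_+ 1) (count i)) (+-comm i 1)

sumℕ-restrict : ∀ f {k} M → k ≤ M → sumℕ f k ≡ sumℕ (λ i → χ< i k * f i) M
sumℕ-restrict f {k} M k≤M = begin
  sumℕ f k                        ≡⟨ sumℕ-cong k (λ i i<k → sym (trans (cong (_* f i) (χ<-< i<k)) (+-identityʳ (f i)))) ⟩
  sumℕ (λ i → χ< i k * f i) k     ≡⟨ sumℕ-extend (λ i → χ< i k * f i) k≤M (λ i k≤i _ → cong (_* f i) (χ<-≮ (≤⇒≯ k≤i))) ⟨
  sumℕ (λ i → χ< i k * f i) M     ∎
  where open ≡-Reasoning

sum² : ℕ → (ℕ → ℕ → ℕ) → ℕ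
sum² n f = sumℕ (λ i → sumℕ (f i) n) n

sum⁴ : ℕ → (ℕ → ℕ → ℕ → ℕ → ℕ) → ℕ
sum⁴ n G = sum² n (λ a b → sum² n (G a b))

sum²-cong : ∀ n {f g} → (∀ a b → f a b ≡ g a b) → sum² n f ≡ sum² n g
sum²-cong n f≡g = sumℕ-cong n (λ a _ → sumℕ-cong n (λ b _ → f≡g a b))

sum⁴-cong : ∀ n {G H} → (∀ a b c d → G a b c d ≡ H a b c d) → sum⁴ n G ≡ sum⁴ n H
sum⁴-cong n G≡H = sum²-cong n (λ a b → sum²-cong n (G≡H a b))

sum²-distrib-+ : ∀ n f g → sum² n (λ a b → f a b + g a b) ≡ sum² n f + sum² n g
sum²-distrib-+ n f g =
  trans (sumℕ-cong n (λ a _ → sumℕ-distrib-+ (f a) (g a) n)) (sumℕ-distrib-+ _ _ n)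

sum⁴-distrib-+ : ∀ n G H → sum⁴ n (λ a b c d → G a b c d + H a b c d) ≡ sum⁴ n G + sum⁴ n H
sum⁴-distrib-+ n G H =
  trans (sum²-cong n (λ a b → sum²-distrib-+ n (G a b) (H a b))) (sum²-distrib-+ n _ _)

*-distribˡ-sum² : ∀ c n f → c * sum² n f ≡ sum² n (λ a b → c * f a b)
*-distribˡ-sum² c n f =
  trans (*-distribˡ-sumℕ c _ n) (sumℕ-cong n (λ a _ → *-distribˡ-sumℕ c (f a) n))

*-distribˡ-sum⁴ : ∀ c n G → c * sum⁴ n G ≡ sum⁴ n (λ a b d e → c * G a b d e)
*-distribˡ-sum⁴ c n G =
  trans (*-distribˡ-sum² c n _) (sum²-cong n (λ a b → *-distribˡ-sum² c n (G a b)))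

sum²-*-sum² : ∀ n f g → sum² n f * sum² n g ≡ sum⁴ n (λ a b c d → f a b * g c d)
sum²-*-sum² n f g =
  trans (*-distribʳ-sumℕ _ _ n) (sumℕ-cong n (λ a _ →
  trans (*-distribʳ-sumℕ _ (f a) n) (sumℕ-cong n (λ b _ → *-distribˡ-sum² (f a b) n g))))

sumℕ-sum²-comm : ∀ T n (H : ℕ → ℕ → ℕ → ℕ) →
  sumℕ (λ t → sum² n (H t)) T ≡ sum² n (λ a b → sumℕ (λ t → H t a b) T)
sumℕ-sum²-comm T n H =
  trans (sumℕ-swap _ T n) (sumℕ-cong n (λ a _ → sumℕ-swap (λ t → H t a) T n))

sumℕ-sum⁴-comm : ∀ T n (H : ℕ → ℕ → ℕ → ℕ → ℕ → ℕ) →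
  sumℕ (λ t → sum⁴ n (H t)) T ≡ sum⁴ n (λ a b c d → sumℕ (λ t → H t a b c d) T)
sumℕ-sum⁴-comm T n H =
  trans (sumℕ-sum²-comm T n _) (sum²-cong n (λ a b → sumℕ-sum²-comm T n (λ t → H t a b)))

sum²-comm : ∀ n f → sum² n f ≡ sum² n (λ b a → f a b)
sum²-comm n f = sumℕ-swap f n n

sum⁴-swap-pairs : ∀ n G → sum⁴ n G ≡ sum⁴ n (λ c d a b → G a b c d)
sum⁴-swap-pairs n G = begin
  sum² n (λ a b → sum² n (G a b))                              ≡⟨ sumℕ-cong n (λ a _ → sumℕ-sum²-comm n n (G a)) ⟩
  sumℕ (λ a → sum² n (λ c d → sumℕ (λ b → G a b c d) n)) n     ≡⟨ sumℕ-sum²-comm n n _ ⟩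
  sum² n (λ c d → sum² n (λ a b → G a b c d))                  ∎
  where open ≡-Reasoning

-- Sums over u₁v₁ + u₂v₂ = n

-- The indices of sum⁴ are u₁ - 1, v₁ - 1, u₂ - 1, v₂ - 1.
Σ₂ : ℕ → (ℕ → ℕ → ℕ → ℕ → ℕ) → ℕ
Σ₂ n W = sum⁴ n (λ i₁ j₁ i₂ j₂ →
  δ (suc i₁ * suc j₁ + suc i₂ * suc j₂) n * W (suc i₁) (suc j₁) (suc i₂) (suc j₂))

Σ₂-cong : ∀ n {W W′} → (∀ u₁ v₁ u₂ v₂ → W u₁ v₁ u₂ v₂ ≡ W′ u₁ v₁ u₂ v₂) → Σ₂ n W ≡ Σ₂ n W′
Σ₂-cong n W≡W′ = sum⁴-cong n (λ i₁ j₁ i₂ j₂ → cong (δ _ n *_) (W≡W′ _ _ _ _))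

Σ₂-distrib-+ : ∀ n W W′ →
  Σ₂ n (λ u₁ v₁ u₂ v₂ → W u₁ v₁ u₂ v₂ + W′ u₁ v₁ u₂ v₂) ≡ Σ₂ n W + Σ₂ n W′
Σ₂-distrib-+ n W W′ =
  trans (sum⁴-cong n (λ i₁ j₁ i₂ j₂ → *-distribˡ-+ (δ _ n) _ _)) (sum⁴-distrib-+ n _ _)

sumℕ-*-Σ₂ : ∀ n M (c : ℕ → ℕ) (W : ℕ → ℕ → ℕ → ℕ → ℕ → ℕ) →
  sumℕ (λ k → c k * Σ₂ n (W k)) M ≡ Σ₂ n (λ u₁ v₁ u₂ v₂ → sumℕ (λ k → c k * W k u₁ v₁ u₂ v₂) M)
sumℕ-*-Σ₂ n M c W =
  trans (sumℕ-cong M (λ k _ → *-distribˡ-sum⁴ (c k) n _))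
  (trans (sumℕ-sum⁴-comm M n (λ k i₁ j₁ i₂ j₂ → c k * (Δ i₁ j₁ i₂ j₂ * w k i₁ j₁ i₂ j₂)))
  (sum⁴-cong n (λ i₁ j₁ i₂ j₂ →
     trans (sumℕ-cong M (λ k _ → x*[y*z]≡y*[x*z] (c k) (Δ i₁ j₁ i₂ j₂) (w k i₁ j₁ i₂ j₂)))
           (sym (*-distribˡ-sumℕ (Δ i₁ j₁ i₂ j₂) (λ k → c k * w k i₁ j₁ i₂ j₂) M)))))
  where
  Δ : ℕ → ℕ → ℕ → ℕ → ℕ
  Δ i₁ j₁ i₂ j₂ = δ (suc i₁ * suc j₁ + suc i₂ * suc j₂) n
  w : ℕ → ℕ → ℕ → ℕ → ℕ → ℕ
  w k i₁ j₁ i₂ j₂ = W k (suc i₁) (suc j₁) (suc i₂) (suc j₂)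
  x*[y*z]≡y*[x*z] : ∀ x y z → x * (y * z) ≡ y * (x * z)
  x*[y*z]≡y*[x*z] = solve 3 (λ x y z → x :* (y :* z) := y :* (x :* z)) refl

Σ₂-swap : ∀ n W → Σ₂ n W ≡ Σ₂ n (λ u₁ v₁ u₂ v₂ → W u₂ v₂ u₁ v₁)
Σ₂-swap n W = trans (sum⁴-swap-pairs n _) (sum⁴-cong n (λ i₁ j₁ i₂ j₂ →
  cong (λ x → δ x n * W (suc i₂) (suc j₂) (suc i₁) (suc j₁)) (+-comm (suc i₂ * suc j₂) (suc i₁ * suc j₁))))

Σ₂-trichotomy : ∀ n W → Σ₂ n W ≡
  Σ₂ n (λ u₁ v₁ u₂ v₂ → χ< v₁ v₂ * W u₁ v₁ u₂ v₂) + Σ₂ n (λ u₁ v₁ u₂ v₂ → χ< v₂ v₁ * W u₁ v₁ u₂ v₂)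
    + Σ₂ n (λ u₁ v₁ u₂ v₂ → δ v₁ v₂ * W u₁ v₁ u₂ v₂)
Σ₂-trichotomy n W =
  trans (Σ₂-cong n split) (trans (Σ₂-distrib-+ n (λ u₁ v₁ u₂ v₂ → W< u₁ v₁ u₂ v₂ + W> u₁ v₁ u₂ v₂) W=)
                                 (cong (_+ Σ₂ n W=) (Σ₂-distrib-+ n W< W>)))
  where
  W< W> W= : ℕ → ℕ → ℕ → ℕ → ℕ
  W< u₁ v₁ u₂ v₂ = χ< v₁ v₂ * W u₁ v₁ u₂ v₂
  W> u₁ v₁ u₂ v₂ = χ< v₂ v₁ * W u₁ v₁ u₂ v₂
  W= u₁ v₁ u₂ v₂ = δ v₁ v₂ * W u₁ v₁ u₂ v₂
  split : ∀ u₁ v₁ u₂ v₂ → W u₁ v₁ u₂ v₂ ≡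
    χ< v₁ v₂ * W u₁ v₁ u₂ v₂ + χ< v₂ v₁ * W u₁ v₁ u₂ v₂ + δ v₁ v₂ * W u₁ v₁ u₂ v₂
  split u₁ v₁ u₂ v₂ = begin
    W u₁ v₁ u₂ v₂                                         ≡⟨ *-identityˡ _ ⟨
    1 * W u₁ v₁ u₂ v₂                                     ≡⟨ cong (_* W u₁ v₁ u₂ v₂) (χ<+δ+χ>≡1 v₁ v₂) ⟨
    (χ< v₁ v₂ + χ< v₂ v₁ + δ v₁ v₂) * W u₁ v₁ u₂ v₂
      ≡⟨ solve 4 (λ a b c w → (a :+ b :+ c) :* w := a :* w :+ b :* w :+ c :* w) refl
           (χ< v₁ v₂) (χ< v₂ v₁) (δ v₁ v₂) (W u₁ v₁ u₂ v₂) ⟩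
    χ< v₁ v₂ * W u₁ v₁ u₂ v₂ + χ< v₂ v₁ * W u₁ v₁ u₂ v₂ + δ v₁ v₂ * W u₁ v₁ u₂ v₂ ∎
    where open ≡-Reasoning

-- Divisor sums as sums over u₁v₁ + u₂v₂ = n

if-≤ᵇ-elim : ∀ {x n} {a b r : ℕ} → (x ≤ n → a ≡ r) → (n < x → b ≡ r) → (if x ℕ.≤ᵇ n then a else b) ≡ r
if-≤ᵇ-elim {x} {n} if-≤ if-> with x ℕ.≤ᵇ n in eq
... | true  = if-≤ (≤ᵇ⇒≤ x n (subst T (sym eq) _))
... | false = if-> (≰⇒> (λ x≤n → subst T eq (≤⇒≤ᵇ x≤n)))

sigmaAux-innermost : ∀ x n y B → (if x ℕ.≤ᵇ n then y * sigmaAux [] (n ∸ x) B else 0) ≡ δ x n * y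
sigmaAux-innermost x n y B = if-≤ᵇ-elim {x} {n}
  (λ x≤n → trans (*-comm y _) (cong (_* y) (trans (sigmaAux-[] (n ∸ x) B)
     (δ-cong-⇔ (λ n∸x≡0 → ≤-antisym x≤n (m∸n≡0⇒m≤n n∸x≡0)) (λ x≡n → trans (cong (n ∸_) x≡n) (n∸n≡0 n))))))
  (λ n<x → sym (cong (_* y) (>⇒δ≡0 n<x)))

sigmaAux-single : ∀ b m B {M} → m ≤ M →
  sigmaAux (b ∷ []) m B ≡ sumℕ (λ i → sumℕ (λ j → δ (suc i * suc j) m * suc j ^ b) M) (B ∸ 1)
sigmaAux-single b m B {M} m≤M = sumℕ-cong (B ∸ 1) (λ i _ →
  trans (sumℕ-cong m (λ j _ → sigmaAux-innermost (suc i * suc j) m (suc j ^ b) (suc i)))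
        (sym (sumℕ-extend _ m≤M (λ j m≤j _ →
           cong (_* suc j ^ b) (>⇒δ≡0 (<-≤-trans (s≤s m≤j) (m≤n*m (suc j) (suc i))))))))

σ-single : ∀ r n {M} → n ≤ M → σ (r ∷ []) n ≡ sum² M (λ i j → δ (suc i * suc j) n * suc j ^ r)
σ-single r n {M} n≤M = trans (sigmaAux-single r n (suc n) n≤M)
  (sym (sumℕ-extend _ n≤M (λ i n≤i _ → sumℕ-≡0 M (λ j _ →
     cong (_* suc j ^ r) (>⇒δ≡0 (<-≤-trans (s≤s n≤i) (m≤m*n (suc i) (suc j))))))))

σ-pair : ∀ a b n → σ (a ∷ b ∷ []) n ≡ Σ₂ n (λ u₁ v₁ u₂ v₂ → χ< u₂ u₁ * (v₁ ^ a * v₂ ^ b))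
σ-pair a b n = sumℕ-cong n (λ i₁ i₁<n → sumℕ-cong n (λ j₁ _ →
  if-≤ᵇ-elim {suc i₁ * suc j₁} {n} (slice i₁ j₁ i₁<n) (λ n<u₁v₁ → sym (sumℕ-≡0 n (λ i₂ _ → sumℕ-≡0 n (λ j₂ _ →
    cong (_* _) (>⇒δ≡0 (<-≤-trans n<u₁v₁ (m≤m+n (suc i₁ * suc j₁) (suc i₂ * suc j₂))))))))))
  where
  slice : ∀ i₁ j₁ → i₁ < n → suc i₁ * suc j₁ ≤ n →
    suc j₁ ^ a * sigmaAux (b ∷ []) (n ∸ suc i₁ * suc j₁) (suc i₁) ≡
    sum² n (λ i₂ j₂ → δ (suc i₁ * suc j₁ + suc i₂ * suc j₂) n * (χ< (suc i₂) (suc i₁) * (suc j₁ ^ a * suc j₂ ^ b)))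
  slice i₁ j₁ i₁<n P≤n = begin
    A * sigmaAux (b ∷ []) m (suc i₁)                        ≡⟨ cong (A *_) (sigmaAux-single b m (suc i₁) (m∸n≤m n P)) ⟩
    A * sumℕ (λ i₂ → sumℕ (g i₂) n) i₁                      ≡⟨ cong (A *_) (sumℕ-restrict _ n (<⇒≤ i₁<n)) ⟩
    A * sumℕ (λ i₂ → χ< i₂ i₁ * sumℕ (g i₂) n) n
      ≡⟨ cong (A *_) (sumℕ-cong n (λ i₂ _ → *-distribˡ-sumℕ (χ< i₂ i₁) (g i₂) n)) ⟩
    A * sum² n (λ i₂ j₂ → χ< i₂ i₁ * g i₂ j₂)               ≡⟨ *-distribˡ-sum² A n _ ⟩
    sum² n (λ i₂ j₂ → A * (χ< i₂ i₁ * g i₂ j₂))             ≡⟨ sum²-cong n rearrange ⟩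
    sum² n (λ i₂ j₂ → δ (P + suc i₂ * suc j₂) n * (χ< (suc i₂) (suc i₁) * (A * suc j₂ ^ b))) ∎
    where
    open ≡-Reasoning
    P = suc i₁ * suc j₁
    m = n ∸ P
    A = suc j₁ ^ a
    g : ℕ → ℕ → ℕ
    g i₂ j₂ = δ (suc i₂ * suc j₂) m * suc j₂ ^ b
    rearrange : ∀ i₂ j₂ →
      A * (χ< i₂ i₁ * g i₂ j₂) ≡ δ (P + suc i₂ * suc j₂) n * (χ< (suc i₂) (suc i₁) * (A * suc j₂ ^ b))
    rearrange i₂ j₂ rewrite δ-∸ (suc i₂ * suc j₂) P≤n | χ<-suc i₂ i₁ =
      solve 4 (λ A c d B → A :* (c :* (d :* B)) := d :* (c :* (A :* B))) refl
        A (χ< i₂ i₁) (δ (suc i₂ * suc j₂) m) (suc j₂ ^ b)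

δ-convolution : ∀ x y n → sumℕ (λ t → δ x t * δ y (n ∸ t)) (suc n) ≡ δ (x + y) n
δ-convolution x y n with x ℕ.≤? n
... | yes x≤n = begin
  sumℕ (λ t → δ x t * δ y (n ∸ t)) (suc n)
    ≡⟨ sumℕ-single _ (suc n) (s≤s x≤n) (λ t _ t≢x → cong (_* δ y (n ∸ t)) (δ-≢ (≢-sym t≢x))) ⟩
  δ x x * δ y (n ∸ x)                        ≡⟨ cong (_* δ y (n ∸ x)) (δ-refl x) ⟩
  1 * δ y (n ∸ x)                            ≡⟨ *-identityˡ _ ⟩
  δ y (n ∸ x)                                ≡⟨ δ-∸ y x≤n ⟨
  δ (x + y) n                                ∎
  where open ≡-Reasoning
... | no x≰n = trans
  (sumℕ-≡0 (suc n) (λ t t<1+n → cong (_* δ y (n ∸ t)) (>⇒δ≡0 (<-≤-trans t<1+n (≰⇒> x≰n)))))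
  (sym (>⇒δ≡0 (<-≤-trans (≰⇒> x≰n) (m≤m+n x y))))

σ-convolution : ∀ a b n →
  sumℕ (λ t → σ (a ∷ []) t * σ (b ∷ []) (n ∸ t)) (suc n) ≡ Σ₂ n (λ _ v₁ _ v₂ → v₁ ^ a * v₂ ^ b)
σ-convolution a b n = begin
  sumℕ (λ t → σ (a ∷ []) t * σ (b ∷ []) (n ∸ t)) (suc n)
    ≡⟨ sumℕ-cong (suc n) (λ t t<1+n → cong₂ _*_ (σ-single a t (≤-pred t<1+n)) (σ-single b (n ∸ t) (m∸n≤m n t))) ⟩
  sumℕ (λ t → sum² n (D a t) * sum² n (D b (n ∸ t))) (suc n)
    ≡⟨ sumℕ-cong (suc n) (λ t _ → sum²-*-sum² n (D a t) (D b (n ∸ t))) ⟩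
  sumℕ (λ t → sum⁴ n (λ i₁ j₁ i₂ j₂ → D a t i₁ j₁ * D b (n ∸ t) i₂ j₂)) (suc n)
    ≡⟨ sumℕ-sum⁴-comm (suc n) n (λ t i₁ j₁ i₂ j₂ → D a t i₁ j₁ * D b (n ∸ t) i₂ j₂) ⟩
  sum⁴ n (λ i₁ j₁ i₂ j₂ → sumℕ (λ t → D a t i₁ j₁ * D b (n ∸ t) i₂ j₂) (suc n))
    ≡⟨ sum⁴-cong n collapse ⟩
  Σ₂ n (λ _ v₁ _ v₂ → v₁ ^ a * v₂ ^ b) ∎
  where
  open ≡-Reasoning
  D : ℕ → ℕ → ℕ → ℕ → ℕ
  D r t i j = δ (suc i * suc j) t * suc j ^ r
  collapse : ∀ i₁ j₁ i₂ j₂ → sumℕ (λ t → D a t i₁ j₁ * D b (n ∸ t) i₂ j₂) (suc n) ≡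
                             δ (suc i₁ * suc j₁ + suc i₂ * suc j₂) n * (suc j₁ ^ a * suc j₂ ^ b)
  collapse i₁ j₁ i₂ j₂ = begin
    sumℕ (λ t → D a t i₁ j₁ * D b (n ∸ t) i₂ j₂) (suc n)
      ≡⟨ sumℕ-cong (suc n) (λ t _ → solve 4 (λ d x e y → (d :* x) :* (e :* y) := (d :* e) :* (x :* y)) refl
           (δ (suc i₁ * suc j₁) t) (suc j₁ ^ a) (δ (suc i₂ * suc j₂) (n ∸ t)) (suc j₂ ^ b)) ⟩
    sumℕ (λ t → δ (suc i₁ * suc j₁) t * δ (suc i₂ * suc j₂) (n ∸ t) * (suc j₁ ^ a * suc j₂ ^ b)) (suc n)
      ≡⟨ *-distribʳ-sumℕ _ (λ t → δ (suc i₁ * suc j₁) t * δ (suc i₂ * suc j₂) (n ∸ t)) (suc n) ⟨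
    sumℕ (λ t → δ (suc i₁ * suc j₁) t * δ (suc i₂ * suc j₂) (n ∸ t)) (suc n) * (suc j₁ ^ a * suc j₂ ^ b)
      ≡⟨ cong (_* (suc j₁ ^ a * suc j₂ ^ b)) (δ-convolution (suc i₁ * suc j₁) (suc i₂ * suc j₂) n) ⟩
    δ (suc i₁ * suc j₁ + suc i₂ * suc j₂) n * (suc j₁ ^ a * suc j₂ ^ b) ∎

sum⁴-rotate : ∀ n G → sum⁴ n G ≡ sumℕ (λ c → sumℕ (λ a → sum² n (λ b d → G a b c d)) n) n
sum⁴-rotate n G = trans (sumℕ-cong n (λ a _ → sumℕ-swap (λ b c → sumℕ (G a b c) n) n n))
                        (sumℕ-swap (λ a c → sum² n (λ b d → G a b c d)) n n)

-- (u₁, v₁, u₂, v₂) ↦ (u₁ - u₂, v₁, u₂, v₁ + v₂) maps the terms with u₂ < u₁ onto those with v₁ < v₂.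
Σ₂-shear : ∀ n (g : ℕ → ℕ → ℕ) →
  Σ₂ n (λ u₁ v₁ u₂ v₂ → χ< u₂ u₁ * g v₁ (v₁ + v₂)) ≡ Σ₂ n (λ u₁ v₁ u₂ v₂ → χ< v₁ v₂ * g v₁ v₂)
Σ₂-shear n g = begin
  sum⁴ n L                                                               ≡⟨ sum⁴-rotate n L ⟩
  sumℕ (λ i₂ → sumℕ (λ i₁ → sum² n (λ j₁ j₂ → L i₁ j₁ i₂ j₂)) n) n       ≡⟨ sumℕ-cong n (λ i₂ _ → shift-u₁ i₂) ⟩
  sumℕ (λ i₂ → sumℕ (λ k₁ → sum² n (λ j₁ j₂ → L (suc i₂ + k₁) j₁ i₂ j₂)) n) n
    ≡⟨ sumℕ-cong n (λ i₂ _ → sumℕ-cong n (λ k₁ _ → sumℕ-cong n (λ j₁ _ → shift-v₂ k₁ j₁ i₂))) ⟩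
  sumℕ (λ i₂ → sumℕ (λ k₁ → sum² n (λ j₁ k₂ → R k₁ j₁ i₂ k₂)) n) n      ≡⟨ sum⁴-rotate n R ⟨
  sum⁴ n R                                                               ∎
  where
  open ≡-Reasoning
  L R : ℕ → ℕ → ℕ → ℕ → ℕ
  L i₁ j₁ i₂ j₂ = δ (suc i₁ * suc j₁ + suc i₂ * suc j₂) n * (χ< (suc i₂) (suc i₁) * g (suc j₁) (suc j₁ + suc j₂))
  R i₁ j₁ i₂ j₂ = δ (suc i₁ * suc j₁ + suc i₂ * suc j₂) n * (χ< (suc j₁) (suc j₂) * g (suc j₁) (suc j₂))
  u₁v₁≥ : ∀ i₁ j₁ i₂ j₂ → suc i₁ ≤ suc i₁ * suc j₁ + suc i₂ * suc j₂
  u₁v₁≥ i₁ j₁ i₂ j₂ = ≤-trans (m≤m*n (suc i₁) (suc j₁)) (m≤m+n (suc i₁ * suc j₁) (suc i₂ * suc j₂))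
  u₂v₂≥ : ∀ i₁ j₁ i₂ j₂ → suc j₂ ≤ suc i₁ * suc j₁ + suc i₂ * suc j₂
  u₂v₂≥ i₁ j₁ i₂ j₂ = ≤-trans (m≤n*m (suc j₂) (suc i₂)) (m≤n+m (suc i₂ * suc j₂) (suc i₁ * suc j₁))
  shift-u₁ : ∀ i₂ → sumℕ (λ i₁ → sum² n (λ j₁ j₂ → L i₁ j₁ i₂ j₂)) n
                  ≡ sumℕ (λ k₁ → sum² n (λ j₁ j₂ → L (suc i₂ + k₁) j₁ i₂ j₂)) n
  shift-u₁ i₂ = sumℕ-shift _ (suc i₂) n
    (λ i₁ i₁≤i₂ → sumℕ-≡0 n (λ j₁ _ → sumℕ-≡0 n (λ j₂ _ →
       x*[c*y]≡0 (δ (suc i₁ * suc j₁ + suc i₂ * suc j₂) n) _ (χ<-≮ (≤⇒≯ (s≤s (≤-pred i₁≤i₂)))))))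
    (λ k₁ n≤ → sumℕ-≡0 n (λ j₁ _ → sumℕ-≡0 n (λ j₂ _ →
       cong (_* _) (>⇒δ≡0 (<-≤-trans (s≤s n≤) (u₁v₁≥ (suc i₂ + k₁) j₁ i₂ j₂))))))
  bijection : ∀ k₁ j₁ i₂ j₂ → L (suc i₂ + k₁) j₁ i₂ j₂ ≡ R k₁ j₁ i₂ (suc j₁ + j₂)
  bijection k₁ j₁ i₂ j₂ = cong₂ _*_
    (cong (λ x → δ x n) (solve 4 (λ k j i l →
       (con 1 :+ (con 1 :+ i :+ k)) :* (con 1 :+ j) :+ (con 1 :+ i) :* (con 1 :+ l)
       := (con 1 :+ k) :* (con 1 :+ j) :+ (con 1 :+ i) :* (con 1 :+ (con 1 :+ j :+ l))) refl k₁ j₁ i₂ j₂))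
    (cong₂ _*_ (trans (χ<-< (s≤s (s≤s (m≤m+n i₂ k₁)))) (sym (χ<-< (s≤s (s≤s (m≤m+n j₁ j₂))))))
               (cong (g (suc j₁)) (+-suc (suc j₁) j₂)))
  shift-v₂ : ∀ k₁ j₁ i₂ → sumℕ (λ j₂ → L (suc i₂ + k₁) j₁ i₂ j₂) n ≡ sumℕ (λ k₂ → R k₁ j₁ i₂ k₂) n
  shift-v₂ k₁ j₁ i₂ = sym (trans
    (sumℕ-shift (R k₁ j₁ i₂) (suc j₁) n
       (λ k₂ k₂≤j₁ → x*[c*y]≡0 (δ (suc k₁ * suc j₁ + suc i₂ * suc k₂) n) _ (χ<-≮ (≤⇒≯ (s≤s (≤-pred k₂≤j₁)))))
       (λ j₂ n≤ → cong (_* _) (>⇒δ≡0 (<-≤-trans (s≤s n≤) (u₂v₂≥ k₁ j₁ i₂ (suc j₁ + j₂))))))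
    (sumℕ-cong n (λ j₂ _ → sym (bijection k₁ j₁ i₂ j₂))))

Σ₂-diagonal : ∀ n (h : ℕ → ℕ → ℕ) → Σ₂ n (λ _ v₁ _ v₂ → δ v₁ v₂ * h v₁ v₂) ≡
  sumℕ (λ j → sum² n (λ i₁ i₂ → δ (suc i₁ * suc j + suc i₂ * suc j) n * h (suc j) (suc j))) n
Σ₂-diagonal n h =
  trans (sumℕ-cong n (λ i₁ _ → sumℕ-cong n (λ j₁ j₁<n → sumℕ-cong n (λ i₂ _ → v₂≡v₁ i₁ j₁ i₂ j₁<n))))
        (sumℕ-swap _ n n)
  where
  v₂≡v₁ : ∀ i₁ j₁ i₂ → j₁ < n →
    sumℕ (λ j₂ → δ (suc i₁ * suc j₁ + suc i₂ * suc j₂) n * (δ (suc j₁) (suc j₂) * h (suc j₁) (suc j₂))) n ≡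
    δ (suc i₁ * suc j₁ + suc i₂ * suc j₁) n * h (suc j₁) (suc j₁)
  v₂≡v₁ i₁ j₁ i₂ j₁<n = trans
    (sumℕ-single _ n j₁<n (λ j₂ _ j₂≢j₁ →
       x*[c*y]≡0 (δ (suc i₁ * suc j₁ + suc i₂ * suc j₂) n) _ (δ-≢ (λ e → j₂≢j₁ (sym (suc-injective e))))))
    (cong (δ (suc i₁ * suc j₁ + suc i₂ * suc j₁) n *_)
          (trans (cong (_* h (suc j₁) (suc j₁)) (δ-refl (suc j₁))) (*-identityˡ _)))

-- If uv = n, there are u - 1 pairs (u₁, u₂) with (u₁ + u₂) v = n.
diagonal-slice : ∀ n v w →
  sum² n (λ i₁ i₂ → δ (suc i₁ * suc v + suc i₂ * suc v) n * w) + sumℕ (λ i → δ (suc i * suc v) n * w) n ≡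
  sumℕ (λ i → δ (suc i * suc v) n * (suc i * w)) n
diagonal-slice n v w = begin
  sum² n (λ i₁ i₂ → δ (suc i₁ * suc v + suc i₂ * suc v) n * w) + sumℕ D n
    ≡⟨ cong (_+ sumℕ D n) (sumℕ-cong n (λ i₁ _ → shift-u₂ i₁)) ⟩
  sumℕ (λ i₁ → sumℕ (λ i → χ< i₁ i * D i) n) n + sumℕ D n
    ≡⟨ cong (_+ sumℕ D n) (sumℕ-swap (λ i₁ i → χ< i₁ i * D i) n n) ⟩
  sumℕ (λ i → sumℕ (λ i₁ → χ< i₁ i * D i) n) n + sumℕ D n
    ≡⟨ cong (_+ sumℕ D n) (sumℕ-cong n (λ i i<n →
         trans (sym (*-distribʳ-sumℕ (D i) (λ i₁ → χ< i₁ i) n)) (cong (_* D i) (sumℕ-χ< n (<⇒≤ i<n))))) ⟩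
  sumℕ (λ i → i * D i) n + sumℕ D n
    ≡⟨ sumℕ-distrib-+ (λ i → i * D i) D n ⟨
  sumℕ (λ i → i * D i + D i) n
    ≡⟨ sumℕ-cong n (λ i _ → solve 3 (λ i d w → i :* (d :* w) :+ d :* w := d :* ((con 1 :+ i) :* w)) refl
                              i (δ (suc i * suc v) n) w) ⟩
  sumℕ (λ i → δ (suc i * suc v) n * (suc i * w)) n ∎
  where
  open ≡-Reasoning
  D : ℕ → ℕ
  D i = δ (suc i * suc v) n * w
  shift-u₂ : ∀ i₁ → sumℕ (λ i₂ → δ (suc i₁ * suc v + suc i₂ * suc v) n * w) n ≡ sumℕ (λ i → χ< i₁ i * D i) n
  shift-u₂ i₁ = sym (trans
    (sumℕ-shift (λ i → χ< i₁ i * D i) (suc i₁) n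
       (λ i i≤i₁ → cong (_* D i) (χ<-≮ (≤⇒≯ (≤-pred i≤i₁))))
       (λ i₂ n≤ → x*[c*y]≡0 (χ< i₁ (suc i₁ + i₂)) w
                    (>⇒δ≡0 (<-≤-trans (s≤s n≤) (m≤m*n (suc (suc i₁ + i₂)) (suc v))))))
    (sumℕ-cong n (λ i₂ _ → trans (cong (_* D (suc i₁ + i₂)) (χ<-< (s≤s (m≤m+n i₁ i₂))))
      (trans (*-identityˡ _) (cong (λ x → δ x n * w)
        (solve 3 (λ a b c → (con 1 :+ (con 1 :+ a :+ b)) :* (con 1 :+ c)
                           := (con 1 :+ a) :* (con 1 :+ c) :+ (con 1 :+ b) :* (con 1 :+ c)) refl i₁ i₂ v))))))

σ-diagonal : ∀ k₁ k₂ r n → k₁ + k₂ ≡ suc r →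
  Σ₂ n (λ _ v₁ _ v₂ → δ v₁ v₂ * (v₁ ^ k₁ * v₂ ^ k₂)) + σ (suc r ∷ []) n ≡ n * σ (r ∷ []) n
σ-diagonal k₁ k₂ r n k₁+k₂≡1+r = begin
  Σ₂ n (λ _ v₁ _ v₂ → δ v₁ v₂ * (v₁ ^ k₁ * v₂ ^ k₂)) + σ (suc r ∷ []) n
    ≡⟨ cong₂ _+_ (Σ₂-diagonal n (λ v₁ v₂ → v₁ ^ k₁ * v₂ ^ k₂))
                 (trans (σ-single (suc r) n ≤-refl) (sum²-comm n _)) ⟩
  sumℕ (λ j → sum² n (λ i₁ i₂ → δ (suc i₁ * suc j + suc i₂ * suc j) n * (suc j ^ k₁ * suc j ^ k₂))) n
    + sumℕ (λ j → sumℕ (λ i → δ (suc i * suc j) n * suc j ^ suc r) n) n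
    ≡⟨ cong (_+ _) (sumℕ-cong n (λ j _ → sum²-cong n (λ i₁ i₂ → cong (δ (suc i₁ * suc j + suc i₂ * suc j) n *_)
         (trans (sym (^-distribˡ-+-* (suc j) k₁ k₂)) (cong (suc j ^_) k₁+k₂≡1+r))))) ⟩
  sumℕ (λ j → sum² n (λ i₁ i₂ → δ (suc i₁ * suc j + suc i₂ * suc j) n * suc j ^ suc r)) n
    + sumℕ (λ j → sumℕ (λ i → δ (suc i * suc j) n * suc j ^ suc r) n) n
    ≡⟨ sumℕ-distrib-+ _ _ n ⟨
  sumℕ (λ j → sum² n (λ i₁ i₂ → δ (suc i₁ * suc j + suc i₂ * suc j) n * suc j ^ suc r)
              + sumℕ (λ i → δ (suc i * suc j) n * suc j ^ suc r) n) n
    ≡⟨ sumℕ-cong n (λ j _ → diagonal-slice n j (suc j ^ suc r)) ⟩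
  sum² n (λ j i → δ (suc i * suc j) n * (suc i * suc j ^ suc r))
    ≡⟨ sum²-cong n (λ j i → uv≡n i j) ⟩
  sum² n (λ j i → n * (δ (suc i * suc j) n * suc j ^ r))
    ≡⟨ *-distribˡ-sum² n n _ ⟨
  n * sum² n (λ j i → δ (suc i * suc j) n * suc j ^ r)
    ≡⟨ cong (n *_) (trans (sum²-comm n _) (sym (σ-single r n ≤-refl))) ⟩
  n * σ (r ∷ []) n ∎
  where
  open ≡-Reasoning
  uv≡n : ∀ i j → δ (suc i * suc j) n * (suc i * suc j ^ suc r) ≡ n * (δ (suc i * suc j) n * suc j ^ r)
  uv≡n i j with suc i * suc j ≟ n
  ... | yes uv≡n rewrite δ-≡ uv≡n | sym uv≡n =
    solve 3 (λ u v p → con 1 :* (u :* (v :* p)) := u :* v :* (con 1 :* p)) refl (suc i) (suc j) (suc j ^ r)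
  ... | no  uv≢n rewrite δ-≢ uv≢n = sym (*-zeroʳ n)

-- Binomial expansions

sumℕ≡sum : ∀ f m → sumℕ f m ≡ Sum.sum {m} (λ k → f (toℕ k))
sumℕ≡sum f zero    = refl
sumℕ≡sum f (suc m) = trans (sumℕ-split f 1 m) (cong (f 0 +_) (sumℕ≡sum (λ i → f (suc i)) m))

×≡* : ∀ m x → m Mult.× x ≡ m * x
×≡* zero    x = refl
×≡* (suc m) x = cong (x +_) (×≡* m x)

^≡^ : ∀ x m → x Exp.^ m ≡ x ^ m
^≡^ x zero    = refl
^≡^ x (suc m) = cong (x *_) (^≡^ x m)

binomial-theorem : ∀ m x y → sumℕ (λ j → (m C j) * (x ^ j * y ^ (m ∸ j))) (suc m) ≡ (x + y) ^ m
binomial-theorem m x y = begin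
  sumℕ (λ j → (m C j) * (x ^ j * y ^ (m ∸ j))) (suc m)
    ≡⟨ sumℕ≡sum _ (suc m) ⟩
  Sum.sum {suc m} (λ k → (m C toℕ k) * (x ^ toℕ k * y ^ (m ∸ toℕ k)))
    ≡⟨ Sum.sum-cong-≗ {suc m} (λ k → sym (trans (×≡* (m C toℕ k) _)
         (cong₂ (λ a b → (m C toℕ k) * (a * b)) (^≡^ x (toℕ k)) (^≡^ y (m ∸ toℕ k))))) ⟩
  Binomial.binomialExpansion x y m
    ≡⟨ Binomial.theorem m x y ⟨
  (x + y) Exp.^ m
    ≡⟨ ^≡^ (x + y) m ⟩
  (x + y) ^ m ∎
  where open ≡-Reasoning

-- shiftedC k m i = C(m, i - k) for k ≤ i and 0 otherwise: the coefficient of xⁱ y^(k+m-i) in xᵏ (x + y)ᵐ.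
shiftedC : ℕ → ℕ → ℕ → ℕ
shiftedC zero    m i       = m C i
shiftedC (suc k) m zero    = 0
shiftedC (suc k) m (suc i) = shiftedC k m i

shiftedC-< : ∀ {k i} m → i < k → shiftedC k m i ≡ 0
shiftedC-< {suc k} {zero}  m _         = refl
shiftedC-< {suc k} {suc i} m (s≤s i<k) = shiftedC-< m i<k

shiftedC-+ : ∀ k m j → shiftedC k m (k + j) ≡ m C j
shiftedC-+ zero    m j = refl
shiftedC-+ (suc k) m j = shiftedC-+ k m j

shifted-binomial-theorem : ∀ k m x y →
  sumℕ (λ i → shiftedC k m i * (x ^ i * y ^ (k + m ∸ i))) (suc (k + m)) ≡ x ^ k * (x + y) ^ m
shifted-binomial-theorem k m x y = begin
  sumℕ f (suc (k + m))                          ≡⟨ cong (sumℕ f) (+-suc k m) ⟨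
  sumℕ f (k + suc m)                            ≡⟨ sumℕ-split f k (suc m) ⟩
  sumℕ f k + sumℕ (λ j → f (k + j)) (suc m)
    ≡⟨ cong₂ _+_ (sumℕ-≡0 k (λ i i<k → cong (_* (x ^ i * y ^ (k + m ∸ i))) (shiftedC-< m i<k)))
                 (sumℕ-cong (suc m) (λ j _ → shifted-term j)) ⟩
  sumℕ (λ j → x ^ k * ((m C j) * (x ^ j * y ^ (m ∸ j)))) (suc m)
                                                ≡⟨ *-distribˡ-sumℕ (x ^ k) _ (suc m) ⟨
  x ^ k * sumℕ (λ j → (m C j) * (x ^ j * y ^ (m ∸ j))) (suc m)
                                                ≡⟨ cong (x ^ k *_) (binomial-theorem m x y) ⟩
  x ^ k * (x + y) ^ m                           ∎
  where
  open ≡-Reasoning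
  f : ℕ → ℕ
  f i = shiftedC k m i * (x ^ i * y ^ (k + m ∸ i))
  shifted-term : ∀ j → f (k + j) ≡ x ^ k * ((m C j) * (x ^ j * y ^ (m ∸ j)))
  shifted-term j rewrite shiftedC-+ k m j | ^-distribˡ-+-* x k j | [m+n]∸[m+o]≡n∸o k m j =
    solve 4 (λ c a b d → c :* (a :* b :* d) := a :* (c :* (b :* d))) refl (m C j) (x ^ k) (x ^ j) (y ^ (m ∸ j))

-- The identity for divisor sums

-- k₁! k₂! times the coefficient of qⁿ in Σ_{a+b=s+2} (C(a-1, k₁) + C(a-1, k₂)) [a, b].
depth-two-sum : ℕ → ℕ → ℕ → ℕ
depth-two-sum k₁ k₂ n =
  sumℕ (λ i → (shiftedC k₁ k₂ i + shiftedC k₂ k₁ i) * σ (i ∷ (k₁ + k₂ ∸ i) ∷ []) n) (suc (k₁ + k₂))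

depth-two-sum-as-Σ₂ : ∀ k₁ k₂ n → depth-two-sum k₁ k₂ n ≡
  Σ₂ n (λ u₁ v₁ u₂ v₂ → χ< u₂ u₁ * (v₁ ^ k₁ * (v₁ + v₂) ^ k₂)) +
  Σ₂ n (λ u₁ v₁ u₂ v₂ → χ< u₂ u₁ * (v₁ ^ k₂ * (v₁ + v₂) ^ k₁))
depth-two-sum-as-Σ₂ k₁ k₂ n =
  trans (sumℕ-cong N (λ i _ → cong (c i *_) (σ-pair i (k₁ + k₂ ∸ i) n)))
  (trans (sumℕ-*-Σ₂ n N c (λ i u₁ v₁ u₂ v₂ → χ< u₂ u₁ * (v₁ ^ i * v₂ ^ (k₁ + k₂ ∸ i))))
  (trans (Σ₂-cong n expand) (Σ₂-distrib-+ n (tail k₁ k₂) (tail k₂ k₁))))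
  where
  N = suc (k₁ + k₂)
  tail : ℕ → ℕ → ℕ → ℕ → ℕ → ℕ → ℕ
  tail a b u₁ v₁ u₂ v₂ = χ< u₂ u₁ * (v₁ ^ a * (v₁ + v₂) ^ b)
  c : ℕ → ℕ
  c i = shiftedC k₁ k₂ i + shiftedC k₂ k₁ i
  expand : ∀ u₁ v₁ u₂ v₂ →
    sumℕ (λ i → c i * (χ< u₂ u₁ * (v₁ ^ i * v₂ ^ (k₁ + k₂ ∸ i)))) N ≡
    χ< u₂ u₁ * (v₁ ^ k₁ * (v₁ + v₂) ^ k₂) + χ< u₂ u₁ * (v₁ ^ k₂ * (v₁ + v₂) ^ k₁)
  expand u₁ v₁ u₂ v₂ = begin
    sumℕ (λ i → c i * (χ * P i)) N
      ≡⟨ sumℕ-cong N (λ i _ → solve 4 (λ a b x p → (a :+ b) :* (x :* p) := x :* (a :* p) :+ x :* (b :* p)) refl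
                                 (shiftedC k₁ k₂ i) (shiftedC k₂ k₁ i) χ (P i)) ⟩
    sumℕ (λ i → χ * (shiftedC k₁ k₂ i * P i) + χ * (shiftedC k₂ k₁ i * P i)) N
      ≡⟨ sumℕ-distrib-+ _ _ N ⟩
    sumℕ (λ i → χ * (shiftedC k₁ k₂ i * P i)) N + sumℕ (λ i → χ * (shiftedC k₂ k₁ i * P i)) N
      ≡⟨ cong₂ _+_ (*-distribˡ-sumℕ χ _ N) (*-distribˡ-sumℕ χ _ N) ⟨
    χ * sumℕ (λ i → shiftedC k₁ k₂ i * P i) N + χ * sumℕ (λ i → shiftedC k₂ k₁ i * P i) N
      ≡⟨ cong₂ (λ a b → χ * a + χ * b) (shifted-binomial-theorem k₁ k₂ v₁ v₂) swapped ⟩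
    χ * (v₁ ^ k₁ * (v₁ + v₂) ^ k₂) + χ * (v₁ ^ k₂ * (v₁ + v₂) ^ k₁) ∎
    where
    open ≡-Reasoning
    χ = χ< u₂ u₁
    P : ℕ → ℕ
    P i = v₁ ^ i * v₂ ^ (k₁ + k₂ ∸ i)
    swapped : sumℕ (λ i → shiftedC k₂ k₁ i * P i) N ≡ v₁ ^ k₂ * (v₁ + v₂) ^ k₁
    swapped rewrite +-comm k₁ k₂ = shifted-binomial-theorem k₂ k₁ v₁ v₂

σ-product-formula : ∀ k₁ k₂ r n → k₁ + k₂ ≡ suc r →
  sumℕ (λ t → σ (k₁ ∷ []) t * σ (k₂ ∷ []) (n ∸ t)) (suc n) + σ (suc r ∷ []) n ≡
  n * σ (r ∷ []) n + depth-two-sum k₁ k₂ n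
σ-product-formula k₁ k₂ r n k₁+k₂≡1+r = begin
  sumℕ (λ t → σ (k₁ ∷ []) t * σ (k₂ ∷ []) (n ∸ t)) (suc n) + σ (suc r ∷ []) n
    ≡⟨ cong (_+ σ (suc r ∷ []) n)
            (trans (σ-convolution k₁ k₂ n) (Σ₂-trichotomy n (λ _ v₁ _ v₂ → v₁ ^ k₁ * v₂ ^ k₂))) ⟩
  B< + B> + B= + σ (suc r ∷ []) n      ≡⟨ +-assoc (B< + B>) B= _ ⟩
  B< + B> + (B= + σ (suc r ∷ []) n)    ≡⟨ cong (B< + B> +_) (σ-diagonal k₁ k₂ r n k₁+k₂≡1+r) ⟩
  B< + B> + n * σ (r ∷ []) n           ≡⟨ +-comm (B< + B>) _ ⟩
  n * σ (r ∷ []) n + (B< + B>)         ≡⟨ cong (n * σ (r ∷ []) n +_) off-diagonal ⟨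
  n * σ (r ∷ []) n + depth-two-sum k₁ k₂ n ∎
  where
  open ≡-Reasoning
  B< B> B= : ℕ
  B< = Σ₂ n (λ _ v₁ _ v₂ → χ< v₁ v₂ * (v₁ ^ k₁ * v₂ ^ k₂))
  B> = Σ₂ n (λ _ v₁ _ v₂ → χ< v₂ v₁ * (v₁ ^ k₁ * v₂ ^ k₂))
  B= = Σ₂ n (λ _ v₁ _ v₂ → δ v₁ v₂ * (v₁ ^ k₁ * v₂ ^ k₂))
  off-diagonal : depth-two-sum k₁ k₂ n ≡ B< + B>
  off-diagonal = trans (depth-two-sum-as-Σ₂ k₁ k₂ n) (cong₂ _+_
    (Σ₂-shear n (λ a b → a ^ k₁ * b ^ k₂))
    (trans (Σ₂-shear n (λ a b → a ^ k₂ * b ^ k₁))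
    (trans (Σ₂-swap n (λ _ v₁ _ v₂ → χ< v₁ v₂ * (v₁ ^ k₂ * v₂ ^ k₁)))
           (Σ₂-cong n (λ _ v₁ _ v₂ → cong (χ< v₂ v₁ *_) (*-comm (v₂ ^ k₂) (v₁ ^ k₁)))))))

-- Coefficients of the brackets

open import Data.Integer as ℤ using (+_)
import Data.Integer.Properties as ℤ
open import Data.Rational as ℚ using (_/_)
import Data.Rational.Properties as ℚ
open import Data.Rational.Unnormalised using (mkℚᵘ; *≡*)
import Data.Rational.Unnormalised.Properties as ℚᵘ
import Algebra.Properties.Group ℚ.+-0-group as ℚ-+-Group

/-cong-cross : ∀ a b A B .{{_ : NonZero A}} .{{_ : NonZero B}} → a * B ≡ b * A → + a / A ≡ + b / B
/-cong-cross a b (suc A) (suc B) a*B≡b*A = ℚ.fromℚᵘ-cong {mkℚᵘ (+ a) A} {mkℚᵘ (+ b) B}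
  (*≡* (trans (sym (ℤ.pos-* a (suc B))) (trans (cong +_ a*B≡b*A) (ℤ.pos-* b (suc A)))))

/-*-/ : ∀ a b A B .{{_ : NonZero A}} .{{_ : NonZero B}} → (+ a / A) ℚ.* (+ b / B) ≡ (+ (a * b) / (A * B)) {{m*n≢0 A B}}
/-*-/ a b (suc A) (suc B) = ℚ.toℚᵘ-injective
  (ℚᵘ.≃-trans (ℚ.toℚᵘ-homo-* (+ a / suc A) (+ b / suc B))
  (ℚᵘ.≃-trans (ℚᵘ.*-cong (ℚ.toℚᵘ-fromℚᵘ (mkℚᵘ (+ a) A)) (ℚ.toℚᵘ-fromℚᵘ (mkℚᵘ (+ b) B)))
  (ℚᵘ.≃-trans (ℚᵘ.≃-reflexive (cong (λ z → mkℚᵘ z (B + A * suc B)) (sym (ℤ.pos-* a b))))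
              (ℚᵘ.≃-sym (ℚ.toℚᵘ-fromℚᵘ (mkℚᵘ (+ (a * b)) (B + A * suc B)))))))

/-+-/ : ∀ a b D .{{_ : NonZero D}} → (+ a / D) ℚ.+ (+ b / D) ≡ + (a + b) / D
/-+-/ a b (suc D) = ℚ.toℚᵘ-injective
  (ℚᵘ.≃-trans (ℚ.toℚᵘ-homo-+ (+ a / suc D) (+ b / suc D))
  (ℚᵘ.≃-trans (ℚᵘ.+-cong (ℚ.toℚᵘ-fromℚᵘ (mkℚᵘ (+ a) D)) (ℚ.toℚᵘ-fromℚᵘ (mkℚᵘ (+ b) D)))
  (ℚᵘ.≃-trans (*≡* cross) (ℚᵘ.≃-sym (ℚ.toℚᵘ-fromℚᵘ (mkℚᵘ (+ (a + b)) D))))))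
  where
  cross : (+ a ℤ.* + suc D ℤ.+ + b ℤ.* + suc D) ℤ.* + suc D ≡ + (a + b) ℤ.* + (suc D * suc D)
  cross = begin
    (+ a ℤ.* + suc D ℤ.+ + b ℤ.* + suc D) ℤ.* + suc D
      ≡⟨ cong₂ (λ x y → (x ℤ.+ y) ℤ.* + suc D) (ℤ.pos-* a (suc D)) (ℤ.pos-* b (suc D)) ⟨
    (+ (a * suc D) ℤ.+ + (b * suc D)) ℤ.* + suc D
      ≡⟨ cong (ℤ._* + suc D) (ℤ.pos-+ (a * suc D) (b * suc D)) ⟨
    + (a * suc D + b * suc D) ℤ.* + suc D
      ≡⟨ ℤ.pos-* (a * suc D + b * suc D) (suc D) ⟨
    + ((a * suc D + b * suc D) * suc D)
      ≡⟨ cong +_ (solve 3 (λ a b d → (a :* d :+ b :* d) :* d := (a :+ b) :* (d :* d)) refl a b (suc D)) ⟩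
    + ((a + b) * (suc D * suc D))
      ≡⟨ ℤ.pos-* (a + b) (suc D * suc D) ⟩
    + (a + b) ℤ.* + (suc D * suc D) ∎
    where open ≡-Reasoning

/-*-/-cross : ∀ a b c A B D .{{_ : NonZero A}} .{{_ : NonZero B}} .{{_ : NonZero D}} →
  a * b * D ≡ c * (A * B) → (+ a / A) ℚ.* (+ b / B) ≡ + c / D
/-*-/-cross a b c A B D cross = trans (/-*-/ a b A B) (/-cong-cross (a * b) c (A * B) D {{m*n≢0 A B}} cross)

sumℚ-cong : ∀ {f g} m → (∀ i → i < m → f i ≡ g i) → sumℚ f m ≡ sumℚ g m
sumℚ-cong zero    f≡g = refl
sumℚ-cong (suc m) f≡g = cong₂ ℚ._+_ (sumℚ-cong m (λ i i<m → f≡g i (m<n⇒m<1+n i<m))) (f≡g m (n<1+n m))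

sumℚ-/ : ∀ f D .{{_ : NonZero D}} m → sumℚ (λ i → + f i / D) m ≡ + sumℕ f m / D
sumℚ-/ f D zero    = sym (ℚ.0/n≡0 D)
sumℚ-/ f D (suc m) = trans (cong (ℚ._+ (+ f m / D)) (sumℚ-/ f D m)) (/-+-/ (sumℕ f m) (f m) D)

bracket-coefficient : ∀ s ss n →
  bracket (s ∷ ss) n ≡ (+ σ (map (_∸ 1) (s ∷ ss)) n / factProd (s ∷ ss)) {{factProd-nz (s ∷ ss)}}
bracket-coefficient s ss zero    = sym (ℚ.0/n≡0 (factProd (s ∷ ss)) {{factProd-nz (s ∷ ss)}})
bracket-coefficient s ss (suc n) = refl

nCk*k!*[n∸k]!≡n! : ∀ {n k} → k ≤ n → (n C k) * (k ! * (n ∸ k) !) ≡ n !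
nCk*k!*[n∸k]!≡n! {n} {k} k≤n =
  trans (cong (_* (k ! * (n ∸ k) !)) (nCk≡n!/k![n-k]! k≤n)) (m/n*n≡m {{k !* (n ∸ k) !≢0}} (k![n∸k]!∣n! k≤n))

C-rescale : ∀ k m i → i ≤ k + m → (i C k) * (k ! * m !) ≡ shiftedC k m i * (i ! * (k + m ∸ i) !)
C-rescale k m i i≤k+m with i <? k
... | yes i<k rewrite k>n⇒nCk≡0 i<k | shiftedC-< m i<k = refl
... | no  i≮k = subst (λ i → (i C k) * (k ! * m !) ≡ shiftedC k m i * (i ! * (k + m ∸ i) !))
                      (m+[n∸m]≡n (≮⇒≥ i≮k))
                      (rescale (i ∸ k) (subst (i ∸ k ≤_) (m+n∸m≡n k m) (∸-monoˡ-≤ k i≤k+m)))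
  where
  rescale : ∀ j → j ≤ m → ((k + j) C k) * (k ! * m !) ≡ shiftedC k m (k + j) * ((k + j) ! * (k + m ∸ (k + j)) !)
  rescale j j≤m rewrite shiftedC-+ k m j | [m+n]∸[m+o]≡n∸o k m j = *-cancelʳ-≡ _ _ (j !) {{j !≢0}} (begin
    ((k + j) C k) * (k ! * m !) * j !        ≡⟨ solve 4 (λ c a b d → c :* (a :* b) :* d := c :* (a :* d) :* b) refl
                                                  ((k + j) C k) (k !) (m !) (j !) ⟩
    ((k + j) C k) * (k ! * j !) * m !        ≡⟨ cong (λ x → ((k + j) C k) * (k ! * x !) * m !) (m+n∸m≡n k j) ⟨
    ((k + j) C k) * (k ! * (k + j ∸ k) !) * m ! ≡⟨ cong (_* m !) (nCk*k!*[n∸k]!≡n! (m≤m+n k j)) ⟩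
    (k + j) ! * m !                          ≡⟨ cong ((k + j) ! *_) (nCk*k!*[n∸k]!≡n! j≤m) ⟨
    (k + j) ! * ((m C j) * (j ! * (m ∸ j) !)) ≡⟨ solve 4 (λ a c d e → a :* (c :* (d :* e)) := c :* (a :* e) :* d) refl
                                                  ((k + j) !) (m C j) (j !) ((m ∸ j) !) ⟩
    (m C j) * ((k + j) ! * (m ∸ j) !) * j !  ∎)
    where open ≡-Reasoning

C-rescale-depth-two : ∀ k₁ k₂ i x → i ≤ k₁ + k₂ →
  (i C k₁ + i C k₂) * x * (k₁ ! * k₂ !) ≡
  (shiftedC k₁ k₂ i + shiftedC k₂ k₁ i) * x * (1 * (i ! * ((k₁ + k₂ ∸ i) ! * 1)))
C-rescale-depth-two k₁ k₂ i x i≤s = begin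
  (i C k₁ + i C k₂) * x * (k₁ ! * k₂ !)
    ≡⟨ solve 5 (λ a b x p q → (a :+ b) :* x :* (p :* q) := x :* (a :* (p :* q) :+ b :* (q :* p))) refl
         (i C k₁) (i C k₂) x (k₁ !) (k₂ !) ⟩
  x * ((i C k₁) * (k₁ ! * k₂ !) + (i C k₂) * (k₂ ! * k₁ !))
    ≡⟨ cong (x *_) (cong₂ _+_ (C-rescale k₁ k₂ i i≤s) k₂-first) ⟩
  x * (shiftedC k₁ k₂ i * (i ! * (s ∸ i) !) + shiftedC k₂ k₁ i * (i ! * (s ∸ i) !))
    ≡⟨ solve 5 (λ x a b p q → x :* (a :* (p :* q) :+ b :* (p :* q)) := (a :+ b) :* x :* (con 1 :* (p :* (q :* con 1))))
         refl x (shiftedC k₁ k₂ i) (shiftedC k₂ k₁ i) (i !) ((s ∸ i) !) ⟩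
  (shiftedC k₁ k₂ i + shiftedC k₂ k₁ i) * x * (1 * (i ! * ((s ∸ i) ! * 1))) ∎
  where
  open ≡-Reasoning
  s = k₁ + k₂
  k₂-first : (i C k₂) * (k₂ ! * k₁ !) ≡ shiftedC k₂ k₁ i * (i ! * (s ∸ i) !)
  k₂-first = trans (C-rescale k₂ k₁ i (subst (i ≤_) (+-comm k₁ k₂) i≤s))
                   (cong (λ t → shiftedC k₂ k₁ i * (i ! * (t ∸ i) !)) (+-comm k₂ k₁))

-- Here s = k₁ + k₂ = suc r, and every coefficient is written over the denominator k₁! k₂!.
module _ (k₁ k₂ r : ℕ) (k₁+k₂≡1+r : k₁ + k₂ ≡ suc r) where

  private
    F : ℕ
    F = k₁ ! * k₂ !

    instance
      F-nonZero : NonZero F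
      F-nonZero = k₁ !* k₂ !≢0
      r!-nonZero : NonZero (r !)
      r!-nonZero = r !≢0
      [1+r]!-nonZero : NonZero (suc r !)
      [1+r]!-nonZero = suc r !≢0
      r!*1-nonZero : NonZero (r ! * 1)
      r!*1-nonZero = factProd-nz (suc r ∷ [])
      [1+r]!*1-nonZero : NonZero (suc r ! * 1)
      [1+r]!*1-nonZero = factProd-nz (suc (suc r) ∷ [])
      k₁!*1-nonZero : NonZero (k₁ ! * 1)
      k₁!*1-nonZero = factProd-nz (suc k₁ ∷ [])
      k₂!*1-nonZero : NonZero (k₂ ! * 1)
      k₂!*1-nonZero = factProd-nz (suc k₂ ∷ [])

  C*F≡[1+r]! : (suc r C k₁) * F ≡ suc r !
  C*F≡[1+r]! = begin
    (suc r C k₁) * F                               ≡⟨ cong (λ s → (s C k₁) * F) k₁+k₂≡1+r ⟨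
    ((k₁ + k₂) C k₁) * (k₁ ! * k₂ !)               ≡⟨ cong (λ x → ((k₁ + k₂) C k₁) * (k₁ ! * x !)) (m+n∸m≡n k₁ k₂) ⟨
    ((k₁ + k₂) C k₁) * (k₁ ! * (k₁ + k₂ ∸ k₁) !)   ≡⟨ nCk*k!*[n∸k]!≡n! (m≤m+n k₁ k₂) ⟩
    (k₁ + k₂) !                                    ≡⟨ cong _! k₁+k₂≡1+r ⟩
    suc r !                                        ∎
    where open ≡-Reasoning

  derivative-coefficient : ∀ n →
    ((suc r C k₁) ·ₛ divₛ (dₛ (bracket (suc r ∷ []))) (suc r)) n ≡ + (n * σ (r ∷ []) n) / F
  derivative-coefficient n = begin
    (+ c / 1) ℚ.* (((+ n / 1) ℚ.* bracket (suc r ∷ []) n) ℚ.* (+ 1 / suc r))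
      ≡⟨ cong (λ x → (+ c / 1) ℚ.* (((+ n / 1) ℚ.* x) ℚ.* (+ 1 / suc r))) (bracket-coefficient (suc r) [] n) ⟩
    (+ c / 1) ℚ.* (((+ n / 1) ℚ.* (+ σ (r ∷ []) n / (r ! * 1))) ℚ.* (+ 1 / suc r))
      ≡⟨ cong (λ x → (+ c / 1) ℚ.* (x ℚ.* (+ 1 / suc r)))
              (/-*-/-cross n (σ (r ∷ []) n) L 1 (r ! * 1) (r !)
                 (solve 3 (λ n x p → n :* x :* p := n :* x :* (con 1 :* (p :* con 1))) refl n (σ (r ∷ []) n) (r !))) ⟩
    (+ c / 1) ℚ.* ((+ L / r !) ℚ.* (+ 1 / suc r))
      ≡⟨ cong ((+ c / 1) ℚ.*_) (/-*-/-cross L 1 L (r !) (suc r) (suc r !)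
                 (solve 3 (λ l s p → l :* con 1 :* (s :* p) := l :* (p :* s)) refl L (suc r) (r !))) ⟩
    (+ c / 1) ℚ.* (+ L / suc r !)
      ≡⟨ /-*-/-cross c L L 1 (suc r !) F
           (trans (solve 3 (λ c l f → c :* l :* f := l :* (c :* f)) refl c L F)
                  (trans (cong (L *_) C*F≡[1+r]!) (sym (cong (L *_) (*-identityˡ (suc r !)))))) ⟩
    + L / F ∎
    where
    open ≡-Reasoning
    c = suc r C k₁
    L = n * σ (r ∷ []) n

  product-coefficient : ∀ n → (bracket (suc k₁ ∷ []) ⊛ bracket (suc k₂ ∷ [])) n ≡
    + sumℕ (λ t → σ (k₁ ∷ []) t * σ (k₂ ∷ []) (n ∸ t)) (suc n) / F
  product-coefficient n = trans (sumℚ-cong (suc n) (λ t _ → term t)) (sumℚ-/ _ F (suc n))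
    where
    term : ∀ t → bracket (suc k₁ ∷ []) t ℚ.* bracket (suc k₂ ∷ []) (n ∸ t) ≡ + (σ (k₁ ∷ []) t * σ (k₂ ∷ []) (n ∸ t)) / F
    term t = trans (cong₂ ℚ._*_ (bracket-coefficient (suc k₁) [] t) (bracket-coefficient (suc k₂) [] (n ∸ t)))
      (/-*-/-cross (σ (k₁ ∷ []) t) (σ (k₂ ∷ []) (n ∸ t)) (σ (k₁ ∷ []) t * σ (k₂ ∷ []) (n ∸ t)) (k₁ ! * 1) (k₂ ! * 1) F
        (solve 4 (λ x y a b → x :* y :* (a :* b) := x :* y :* ((a :* con 1) :* (b :* con 1))) refl
           (σ (k₁ ∷ []) t) (σ (k₂ ∷ []) (n ∸ t)) (k₁ !) (k₂ !)))

  shift-coefficient : ∀ n → ((suc r C k₁) ·ₛ bracket (suc (suc r) ∷ [])) n ≡ + σ (suc r ∷ []) n / F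
  shift-coefficient n = trans (cong ((+ c / 1) ℚ.*_) (bracket-coefficient (suc (suc r)) [] n))
    (/-*-/-cross c Q Q 1 (suc r ! * 1) F
      (trans (solve 3 (λ c q f → c :* q :* f := q :* (c :* f)) refl c Q F)
             (trans (cong (Q *_) C*F≡[1+r]!) (cong (Q *_) (sym (trans (*-identityˡ _) (*-identityʳ _)))))))
    where
    c = suc r C k₁
    Q = σ (suc r ∷ []) n

  depth-two-coefficient : ∀ n →
    sumₛ (λ i → (i C k₁ + i C k₂) ·ₛ bracket (suc i ∷ ((suc r + 2) ∸ suc i) ∷ [])) (suc r + 1) n ≡
    + depth-two-sum k₁ k₂ n / F
  depth-two-coefficient n = begin
    sumℚ (λ i → (+ (i C k₁ + i C k₂) / 1) ℚ.* bracket (suc i ∷ ((suc r + 2) ∸ suc i) ∷ []) n) (suc r + 1)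
      ≡⟨ sumℚ-cong (suc r + 1) (λ i i<1+r+1 → term i (≤-pred (subst (i <_) 1+r+1≡1+k₁+k₂ i<1+r+1))) ⟩
    sumℚ (λ i → + g i / F) (suc r + 1)
      ≡⟨ sumℚ-/ g F (suc r + 1) ⟩
    + sumℕ g (suc r + 1) / F
      ≡⟨ cong (λ m → + sumℕ g m / F) 1+r+1≡1+k₁+k₂ ⟩
    + depth-two-sum k₁ k₂ n / F ∎
    where
    open ≡-Reasoning
    s = k₁ + k₂
    1+r+1≡1+k₁+k₂ : suc r + 1 ≡ suc s
    1+r+1≡1+k₁+k₂ = trans (+-comm (suc r) 1) (cong suc (sym k₁+k₂≡1+r))
    g : ℕ → ℕ
    g i = (shiftedC k₁ k₂ i + shiftedC k₂ k₁ i) * σ (i ∷ (s ∸ i) ∷ []) n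
    second-index : ∀ i → i ≤ s → (suc r + 2) ∸ suc i ≡ suc (s ∸ i)
    second-index i i≤s = begin
      suc r + 2 ∸ suc i  ≡⟨ cong (λ x → x + 2 ∸ suc i) k₁+k₂≡1+r ⟨
      s + 2 ∸ suc i      ≡⟨ cong (_∸ suc i) (+-comm s 2) ⟩
      suc s ∸ i          ≡⟨ +-∸-assoc 1 i≤s ⟩
      suc (s ∸ i)        ∎
    term : ∀ i → i ≤ s →
      (+ (i C k₁ + i C k₂) / 1) ℚ.* bracket (suc i ∷ ((suc r + 2) ∸ suc i) ∷ []) n ≡ + g i / F
    term i i≤s rewrite second-index i i≤s =
      trans (cong ((+ (i C k₁ + i C k₂) / 1) ℚ.*_) (bracket-coefficient (suc i) (suc (s ∸ i) ∷ []) n))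
            (/-*-/-cross (i C k₁ + i C k₂) (σ (i ∷ (s ∸ i) ∷ []) n) (g i) 1 (i ! * ((s ∸ i) ! * 1)) F
               {{_}} {{factProd-nz (suc i ∷ suc (s ∸ i) ∷ [])}} (C-rescale-depth-two k₁ k₂ i _ i≤s))

  coefficient-identity :
    (suc r C k₁) ·ₛ divₛ (dₛ (bracket (suc r ∷ []))) (suc r)
      ≈ₛ bracket (suc k₁ ∷ []) ⊛ bracket (suc k₂ ∷ [])
         ⊕ (suc r C k₁) ·ₛ bracket (suc (suc r) ∷ [])
         ⊖ sumₛ (λ i → (i C k₁ + i C k₂) ·ₛ bracket (suc i ∷ ((suc r + 2) ∸ suc i) ∷ [])) (suc r + 1)
  coefficient-identity n = begin
    ((suc r C k₁) ·ₛ divₛ (dₛ (bracket (suc r ∷ []))) (suc r)) n ≡⟨ derivative-coefficient n ⟩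
    + L / F                                  ≡⟨ ℚ-+-Group.//-rightDividesʳ (+ S / F) (+ L / F) ⟨
    (+ L / F ℚ.+ + S / F) ℚ.- + S / F        ≡⟨ cong (ℚ._- + S / F) (/-+-/ L S F) ⟩
    + (L + S) / F ℚ.- + S / F                ≡⟨ cong (λ x → + x / F ℚ.- + S / F) (σ-product-formula k₁ k₂ r n k₁+k₂≡1+r) ⟨
    + (P + Q) / F ℚ.- + S / F                ≡⟨ cong (ℚ._- + S / F) (/-+-/ P Q F) ⟨
    (+ P / F ℚ.+ + Q / F) ℚ.- + S / F        ≡⟨ cong₂ ℚ._-_ (cong₂ ℚ._+_ (product-coefficient n) (shift-coefficient n))
                                                            (depth-two-coefficient n) ⟨
    (bracket (suc k₁ ∷ []) ⊛ bracket (suc k₂ ∷ []) ⊕ (suc r C k₁) ·ₛ bracket (suc (suc r) ∷ [])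
      ⊖ sumₛ (λ i → (i C k₁ + i C k₂) ·ₛ bracket (suc i ∷ ((suc r + 2) ∸ suc i) ∷ [])) (suc r + 1)) n ∎
    where
    open ≡-Reasoning
    L = n * σ (r ∷ []) n
    S = depth-two-sum k₁ k₂ n
    P = sumℕ (λ t → σ (k₁ ∷ []) t * σ (k₂ ∷ []) (n ∸ t)) (suc n)
    Q = σ (suc r ∷ []) n

mainTheorem11 : (s₁ s₂ : ℕ) → s₁ ≥ 1 → s₂ ≥ 1 → s₁ + s₂ > 2 →
    let s = s₁ + s₂ ∸ 2 in
    (s C (s₁ ∸ 1)) ·ₛ divₛ (dₛ (bracket (s ∷ []))) s
      ≈ₛ bracket (s₁ ∷ []) ⊛ bracket (s₂ ∷ [])
         ⊕ (s C (s₁ ∸ 1)) ·ₛ bracket (suc s ∷ [])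
         ⊖ sumₛ (λ i → (i C (s₁ ∸ 1) + i C (s₂ ∸ 1))
                   ·ₛ bracket (suc i ∷ ((s + 2) ∸ suc i) ∷ []))
                (s + 1)
mainTheorem11 (suc k₁) (suc k₂) (s≤s z≤n) (s≤s z≤n) s₁+s₂>2 with suc k₁ + suc k₂ ∸ 2 in s≡
... | zero  = ⊥-elim (<⇒≱ s₁+s₂>2 (m∸n≡0⇒m≤n s≡))
... | suc r = coefficient-identity k₁ k₂ r (trans (cong (_∸ 1) (sym (+-suc k₁ k₂))) s≡)
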